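{- For $n=1,2,3,\dots$, $$[n]_{\mathbb{Z},\mathbb{N}}=\prod_{b=2}^n b^{\operatorname{ord}_b(n)},$$ where $\operatorname{ord}_b(n)$ is the largest $\alpha\in\mathbb{N}$ with $b^\alpha\mid n$.
   Context: For integers $b\ge0$ and $a\in\mathbb{Z}$ let $\operatorname{ord}_b(a):=\sup\{k\in\mathbb{N}: a\mathbb{Z}\subseteq b^k\mathbb{Z}\}$ (convention $0^0=1$); for $b\ge2$ this is the largest $k$ with $b^k\mid a$; $\operatorname{ord}_1\equiv+\infty$; $\operatorname{ord}_0(a)=0$ for $a\ne0$, $\operatorname{ord}_0(0)=+\infty$. For nonempty $S\subseteq\mathbb{Z}$, a $b$-ordering of $S$ is an infinite sequence $(a_i)_{i\ge0}$ in $S$ such that for every $i\ge1$, $\sum_{j<i}\operatorname{ord}_b(a_i-a_j)=\min_{a'\in S}\sum_{j<i}\operatorname{ord}_b(a'-a_j)$. The quantity $\alpha_k(S,b):=\sum_{j<k}\operatorname{ord}_b(a_k-a_j)$ (with $\alpha_0=0$) does not depend on the choice of $b$-ordering. For $\mathcal{T}\subseteq\mathbb{N}$, $k!_{S,\mathcal{T}}:=\prod_{b\in\mathcal{T}}b^{\alpha_k(S,b)}$, with conventions $b^{+\infty}=0$ for $b\ge2$ and $b=0$, $1^{+\infty}=1$, $b^0=1$. The generalized integer is $[n]_{S,\mathcal{T}}:=n!_{S,\mathcal{T}}/(n-1)!_{S,\mathcal{T}}$ for positive $n<|S|$. -}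

module Defs where

open import Data.Nat using (ℕ; zero; suc; _+_; _*_; _∸_; _^_; _≤_)
import Data.Nat as N
open import Data.Nat.Divisibility using (_∣?_)
open import Data.Integer as Z using (ℤ; ∣_∣; _-_)
open import Data.Product using (Σ; _×_)
open import Relation.Nullary using (yes; no; ¬_)
open import Relation.Binary.PropositionalEquality using (_≡_)

data ℕ∞ : Set where
  fin : ℕ → ℕ∞
  ∞   : ℕ∞

infixl 6 _+∞_
_+∞_ : ℕ∞ → ℕ∞ → ℕ∞
fin m +∞ fin n = fin (m + n)
fin _ +∞ ∞     = ∞
∞     +∞ _     = ∞

infix 4 _≤∞_
data _≤∞_ : ℕ∞ → ℕ∞ → Set where
  fin≤fin : ∀ {m n} → m ≤ n → fin m ≤∞ fin n
  _≤∞∞    : ∀ x → x ≤∞ ∞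

-- greatest k ≤ N with b^k ∣ m  (0 if none; for m ≥ 1 such k are < m)
greatestPowDiv : ℕ → ℕ → ℕ → ℕ
greatestPowDiv b m zero = zero
greatestPowDiv b m (suc N) with (b ^ suc N) ∣? m
... | yes _ = suc N
... | no _  = greatestPowDiv b m N

ord : ℕ → ℤ → ℕ∞
ord zero a with ∣ a ∣ N.≟ 0
... | yes _ = ∞
... | no _  = fin 0
ord (suc zero) a = ∞
ord (suc (suc c)) a with ∣ a ∣ N.≟ 0
... | yes _ = ∞
... | no _  = fin (greatestPowDiv (suc (suc c)) ∣ a ∣ ∣ a ∣)

sumBelow : (ℕ → ℕ∞) → ℕ → ℕ∞
sumBelow f zero    = fin 0
sumBelow f (suc i) = sumBelow f i +∞ f i

-- b-ordering of S ⊆ ℤ (S given as a predicate).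
-- Since a_i ∈ S, "equal to the minimum over S" is the same as
-- "≤ the value at every a' ∈ S".
IsBOrdering : (ℤ → Set) → ℕ → (ℕ → ℤ) → Set
IsBOrdering S b a =
  ((i : ℕ) → S (a i)) ×
  ((i : ℕ) → 1 ≤ i → (a' : ℤ) → S a' →
     sumBelow (λ j → ord b (a i - a j)) i ≤∞ sumBelow (λ j → ord b (a' - a j)) i)

alphaOf : ℕ → (ℕ → ℤ) → ℕ → ℕ∞
alphaOf b a k = sumBelow (λ j → ord b (a k - a j)) k

pow∞ : ℕ → ℕ∞ → ℕ
pow∞ b (fin k)      = b ^ k
pow∞ (suc zero) ∞   = 1
pow∞ _ ∞            = 0

prodBelow : (ℕ → ℕ) → ℕ → ℕ
prodBelow f zero    = 1
prodBelow f (suc N) = prodBelow f N * f N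

HasProduct : (ℕ → ℕ) → ℕ → Set
HasProduct f v = Σ ℕ (λ N → ((b : ℕ) → N ≤ b → f b ≡ 1) × (prodBelow f N ≡ v))

-- k!_{ℤ,ℕ} = v, where orders b is a chosen b-ordering of ℤ for each b ∈ ℕ
IsFactorialℤℕ : (ℕ → ℕ → ℤ) → ℕ → ℕ → Set
IsFactorialℤℕ orders k v = HasProduct (λ b → pow∞ b (alphaOf b (orders b) k)) v

-- [n]_{ℤ,ℕ} = q  :⇔  n!/(n-1)! = q, i.e. (n-1)! ≠ 0 and n! = q · (n-1)!
IsGenIntℤℕ : (ℕ → ℕ → ℤ) → ℕ → ℕ → Set
IsGenIntℤℕ orders n q =
  Σ ℕ (λ F → Σ ℕ (λ G →
    IsFactorialℤℕ orders n F × IsFactorialℤℕ orders (n ∸ 1) G ×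
    (¬ G ≡ 0) × (F ≡ q * G)))

prod2To : (ℕ → ℕ) → ℕ → ℕ
prod2To f n = prodBelow (λ k → f (2 + k)) (n ∸ 1)

{-# OPTIONS --safe #-}
module Submission where

-- For b = 0 every α_k(ℤ,0) vanishes (take a′ far from the a_j) and every power of 1 is 1, so
-- only b ≥ 2 contributes.  There α_k(ℤ,b) = Σ_{e≥1} ⌊k/b^e⌋, and since ⌊(m+1)/q⌋ − ⌊m/q⌋ is 1
-- exactly when q ∣ m+1, the quotient n!/(n−1)! has b-exponent #{e ≥ 1 : b^e ∣ n} = ord_b(n).
--
-- For the formula, let c_e(x) count the j < k with a_j ≡ x (mod b^e); then
-- Σ_{j<k} ord_b(x − a_j) = Σ_{e≥1} c_e(x).  Choosing x digit by digit in base b, each time in a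
-- least populated of the b classes refining the previous one, gives c_e(x) ≤ ⌊k/b^e⌋ and hence
-- α_k ≤ Σ ⌊k/b^e⌋.  Conversely, as long as the counts of the b^e classes differ pairwise by at
-- most one, every class holds at least ⌊k/b^e⌋ points, which gives α_k ≥ Σ ⌊k/b^e⌋.  Equality
-- then forces a_k into a least populated class at every level, so this balance survives the
-- step from k to k + 1, and induction on k concludes.

open import Defs
open import Data.Nat using (ℕ; _≤_)
open import Data.Integer using (ℤ; +_)
open import Data.Unit using (⊤)

open import Data.Empty using (⊥-elim)
open import Data.Integer as ℤ using (∣_∣; _-_; _%ℕ_; _/ℕ_)
import Data.Integer.DivMod as ℤ
import Data.Integer.Divisibility.Signed as Signed
import Data.Integer.Properties as ℤ
open import Data.Integer.Solver using (module +-*-Solver)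
open import Data.Nat
  using (zero; suc; pred; _+_; _*_; _∸_; _^_; _<_; _⊔_; _≟_; _≤?_; z≤n; s≤s;
         NonZero; ≢-nonZero; ≢-nonZero⁻¹)
open import Data.Nat.DivMod
open import Data.Nat.Divisibility
  using (_∣_; _∣?_; divides; >⇒∤; n∣m⇒m%n≡0; ∣-trans; ∣⇒≤; _∣0; ∣n⇒∣m*n)
open import Data.Nat.Properties
open import Algebra.Properties.CommutativeSemigroup +-commutativeSemigroup
  using () renaming (interchange to +-interchange)
open import Algebra.Properties.CommutativeSemigroup *-commutativeSemigroup
  using () renaming (interchange to *-interchange)
open import Data.Product using (∃; _×_; _,_; proj₁; proj₂)
open import Data.Sum using (inj₁; inj₂; [_,_]′)
open import Data.Unit using (tt)
open import Relation.Nullary using (Dec; yes; no; ¬_)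
open import Relation.Binary.PropositionalEquality

𝟙 : ∀ {p} {P : Set p} → Dec P → ℕ
𝟙 (yes _) = 1
𝟙 (no _)  = 0

𝟙≤1 : ∀ {p} {P : Set p} (d : Dec P) → 𝟙 d ≤ 1
𝟙≤1 (yes _) = s≤s z≤n
𝟙≤1 (no _)  = z≤n

𝟙-yes : ∀ {p} {P : Set p} → P → (d : Dec P) → 𝟙 d ≡ 1
𝟙-yes _ (yes _) = refl
𝟙-yes p (no ¬p) = ⊥-elim (¬p p)

𝟙-no : ∀ {p} {P : Set p} → ¬ P → (d : Dec P) → 𝟙 d ≡ 0
𝟙-no ¬p (yes p) = ⊥-elim (¬p p)
𝟙-no _  (no _)  = refl

𝟙-cong : ∀ {p q} {P : Set p} {Q : Set q} (d : Dec P) (d′ : Dec Q) →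
         (P → Q) → (Q → P) → 𝟙 d ≡ 𝟙 d′
𝟙-cong (yes p) d′ to _    = sym (𝟙-yes (to p) d′)
𝟙-cong (no ¬p) d′ _  from = sym (𝟙-no (λ q → ¬p (from q)) d′)

∀<suc⇒∀< : ∀ {P : ℕ → Set} {n} → (∀ i → i < suc n → P i) → ∀ i → i < n → P i
∀<suc⇒∀< h i i<n = h i (m<n⇒m<1+n i<n)

∑< : (ℕ → ℕ) → ℕ → ℕ
∑< f zero    = 0
∑< f (suc n) = ∑< f n + f n

∑<-cong : ∀ {f g} n → (∀ i → i < n → f i ≡ g i) → ∑< f n ≡ ∑< g n
∑<-cong zero    h = refl
∑<-cong (suc n) h = cong₂ _+_ (∑<-cong n (∀<suc⇒∀< h)) (h n ≤-refl)

∑<-mono-≤ : ∀ {f g} n → (∀ i → i < n → f i ≤ g i) → ∑< f n ≤ ∑< g n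
∑<-mono-≤ zero    h = z≤n
∑<-mono-≤ (suc n) h = +-mono-≤ (∑<-mono-≤ n (∀<suc⇒∀< h)) (h n ≤-refl)

∑<-const : ∀ c n → ∑< (λ _ → c) n ≡ n * c
∑<-const c zero    = refl
∑<-const c (suc n) = trans (cong (_+ c) (∑<-const c n)) (+-comm (n * c) c)

∑<-distrib-+ : ∀ f g n → ∑< (λ i → f i + g i) n ≡ ∑< f n + ∑< g n
∑<-distrib-+ f g zero    = refl
∑<-distrib-+ f g (suc n) =
  trans (cong (_+ (f n + g n)) (∑<-distrib-+ f g n)) (+-interchange (∑< f n) (∑< g n) (f n) (g n))

∑<-comm : ∀ (f : ℕ → ℕ → ℕ) m n →
          ∑< (λ i → ∑< (f i) n) m ≡ ∑< (λ j → ∑< (λ i → f i j) m) n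
∑<-comm f zero    n = trans (sym (*-zeroʳ n)) (sym (∑<-const 0 n))
∑<-comm f (suc m) n =
  trans (cong (_+ ∑< (f m) n) (∑<-comm f m n)) (sym (∑<-distrib-+ _ (f m) n))

∑<-term≤ : ∀ f n {i} → i < n → f i ≤ ∑< f n
∑<-term≤ f (suc n) i<1+n with m<1+n⇒m<n∨m≡n i<1+n
... | inj₁ i<n  = ≤-trans (∑<-term≤ f n i<n) (m≤m+n _ _)
... | inj₂ refl = m≤n+m _ _

∑<-prefix≤ : ∀ f {m n} → m ≤ n → ∑< f m ≤ ∑< f n
∑<-prefix≤ f {n = zero}  z≤n = z≤n
∑<-prefix≤ f {n = suc n} m≤1+n with m≤n⇒m<n∨m≡n m≤1+n
... | inj₁ m<1+n = ≤-trans (∑<-prefix≤ f (≤-pred m<1+n)) (m≤m+n _ _)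
... | inj₂ refl  = ≤-refl

∑<-vanishing : ∀ f {m n} → (∀ i → m ≤ i → f i ≡ 0) → m ≤ n → ∑< f n ≡ ∑< f m
∑<-vanishing f {n = zero}  _ z≤n = refl
∑<-vanishing f {n = suc n} h m≤1+n with m≤n⇒m<n∨m≡n m≤1+n
... | inj₁ m<1+n = trans (cong₂ _+_ (∑<-vanishing f h (≤-pred m<1+n)) (h n (≤-pred m<1+n)))
                         (+-identityʳ _)
... | inj₂ refl  = refl

∑<-<-* : ∀ f n B {r} → (∀ i → i < n → f i ≤ B) → r < n → f r < B → ∑< f n < n * B
∑<-<-* f (suc n) B h r<1+n fr<B with m<1+n⇒m<n∨m≡n r<1+n
... | inj₁ r<n  = subst (∑< f n + f n <_) (+-comm (n * B) B)
                    (+-mono-<-≤ (∑<-<-* f n B (∀<suc⇒∀< h) r<n fr<B) (h n ≤-refl))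
... | inj₂ refl = subst (∑< f n + f n <_) (+-comm (n * B) B)
                    (+-mono-≤-< (subst (∑< f n ≤_) (∑<-const B n) (∑<-mono-≤ n (∀<suc⇒∀< h))) fr<B)

∑<-𝟙-≟ : ∀ {c} n → c < n → ∑< (λ r → 𝟙 (c ≟ r)) n ≡ 1
∑<-𝟙-≟ {c} (suc n) c<1+n with m<1+n⇒m<n∨m≡n c<1+n
... | inj₁ c<n  = cong₂ _+_ (∑<-𝟙-≟ n c<n) (𝟙-no (<⇒≢ c<n) (c ≟ n))
... | inj₂ refl = cong₂ _+_ (trans (∑<-cong n (λ r r<c → 𝟙-no (>⇒≢ r<c) (c ≟ r)))
                                   (trans (∑<-const 0 n) (*-zeroʳ n)))
                            (𝟙-yes refl (c ≟ c))

∑<-pointwise-≡ : ∀ {f g} n → (∀ i → i < n → f i ≤ g i) → ∑< g n ≤ ∑< f n →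
                 ∀ i → i < n → f i ≡ g i
∑<-pointwise-≡ {f} {g} (suc n) f≤g ∑g≤∑f i i<1+n with m<1+n⇒m<n∨m≡n i<1+n
... | inj₁ i<n  = ∑<-pointwise-≡ n (∀<suc⇒∀< f≤g) ∑g≤∑f′ i i<n
  where
  ∑g≤∑f′ : ∑< g n ≤ ∑< f n
  ∑g≤∑f′ = +-cancelʳ-≤ (g n) _ _ (≤-trans ∑g≤∑f (+-monoʳ-≤ (∑< f n) (f≤g n ≤-refl)))
... | inj₂ refl = ≤-antisym (f≤g n ≤-refl) gn≤fn
  where
  gn≤fn : g n ≤ f n
  gn≤fn = +-cancelˡ-≤ (∑< g n) _ _
            (≤-trans ∑g≤∑f (+-monoˡ-≤ (f n) (∑<-mono-≤ n (∀<suc⇒∀< f≤g))))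

∃-argmin : ∀ (f : ℕ → ℕ) n → ∃ λ t → t < suc n × (∀ i → i < suc n → f t ≤ f i)
∃-argmin f zero    = 0 , s≤s z≤n , λ { zero _ → ≤-refl ; (suc _) (s≤s ()) }
∃-argmin f (suc n) with ∃-argmin f n
... | t , t<1+n , min with f t ≤? f (suc n)
...   | yes ft≤fn = t , m<n⇒m<1+n t<1+n , λ i i<2+n →
          [ min i , (λ { refl → ft≤fn }) ]′ (m<1+n⇒m<n∨m≡n i<2+n)
...   | no ft≰fn  = suc n , ≤-refl , λ i i<2+n →
          [ (λ i<1+n → ≤-trans (<⇒≤ (≰⇒> ft≰fn)) (min i i<1+n)) , (λ { refl → ≤-refl }) ]′
            (m<1+n⇒m<n∨m≡n i<2+n)

∃-*≤∑< : ∀ f n → ∃ λ t → t < suc n × f t * suc n ≤ ∑< f (suc n)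
∃-*≤∑< f n with ∃-argmin f n
... | t , t<1+n , min = t , t<1+n ,
      subst (_≤ ∑< f (suc n)) (trans (∑<-const (f t) (suc n)) (*-comm (suc n) (f t)))
            (∑<-mono-≤ (suc n) min)

≤∞-trans : ∀ {x y z} → x ≤∞ y → y ≤∞ z → x ≤∞ z
≤∞-trans (fin≤fin p) (fin≤fin q) = fin≤fin (≤-trans p q)
≤∞-trans _           (_ ≤∞∞)     = _ ≤∞∞

≤∞-antisym-fin : ∀ {x n} → x ≤∞ fin n → fin n ≤∞ x → x ≡ fin n
≤∞-antisym-fin (fin≤fin p) (fin≤fin q) = cong fin (≤-antisym p q)

fin-≤∞⁻¹ : ∀ {m n} → fin m ≤∞ fin n → m ≤ n
fin-≤∞⁻¹ (fin≤fin p) = p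

+∞-mono-≤ : ∀ {m n x y} → fin m ≤∞ x → fin n ≤∞ y → fin (m + n) ≤∞ x +∞ y
+∞-mono-≤ (fin≤fin p) (fin≤fin q) = fin≤fin (+-mono-≤ p q)
+∞-mono-≤ (fin≤fin _) (_ ≤∞∞)     = _ ≤∞∞
+∞-mono-≤ (_ ≤∞∞)     _           = _ ≤∞∞

sumBelow-fin : ∀ f g k → (∀ j → j < k → f j ≡ fin (g j)) → sumBelow f k ≡ fin (∑< g k)
sumBelow-fin f g zero    h = refl
sumBelow-fin f g (suc k) h = cong₂ _+∞_ (sumBelow-fin f g k (∀<suc⇒∀< h)) (h k ≤-refl)

∑<≤sumBelow : ∀ f g k → (∀ j → j < k → fin (g j) ≤∞ f j) → fin (∑< g k) ≤∞ sumBelow f k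
∑<≤sumBelow f g zero    h = fin≤fin z≤n
∑<≤sumBelow f g (suc k) h = +∞-mono-≤ (∑<≤sumBelow f g k (∀<suc⇒∀< h)) (h k ≤-refl)

∣∧<⇒≡0 : ∀ {m n} → m ∣ n → n < m → n ≡ 0
∣∧<⇒≡0 {n = zero}  _   _   = refl
∣∧<⇒≡0 {n = suc _} m∣n n<m = ⊥-elim (>⇒∤ n<m m∣n)

module _ (n : ℕ) .{{_ : NonZero n}} where

  private
    i-j≡[i%-j%]+[i/-j/]*n : ∀ i j →
      i - j ≡ (+ (i %ℕ n) - + (j %ℕ n)) ℤ.+ (i /ℕ n - j /ℕ n) ℤ.* + n
    i-j≡[i%-j%]+[i/-j/]*n i j =
      trans (cong₂ _-_ (ℤ.a≡a%ℕn+[a/ℕn]*n i n) (ℤ.a≡a%ℕn+[a/ℕn]*n j n))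
      (solve 5 (λ r s q t m → (r :+ q :* m) :- (s :+ t :* m) := (r :- s) :+ (q :- t) :* m) refl
         (+ (i %ℕ n)) (+ (j %ℕ n)) (i /ℕ n) (j /ℕ n) (+ n))
      where open +-*-Solver

  i%ℕn≡j%ℕn⇒n∣∣i-j∣ : ∀ i j → i %ℕ n ≡ j %ℕ n → n ∣ ∣ i - j ∣
  i%ℕn≡j%ℕn⇒n∣∣i-j∣ i j i%n≡j%n =
    divides ∣ q ∣ (trans (cong ∣_∣ i-j≡q*n) (ℤ.abs-* q (+ n)))
    where
    q : ℤ
    q = i /ℕ n - j /ℕ n
    i-j≡q*n : i - j ≡ q ℤ.* + n
    i-j≡q*n = trans (i-j≡[i%-j%]+[i/-j/]*n i j)
      (trans (cong (ℤ._+ q ℤ.* + n) (ℤ.i≡j⇒i-j≡0 (cong +_ i%n≡j%n))) (ℤ.+-identityˡ (q ℤ.* + n)))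

  n∣∣i-j∣⇒i%ℕn≡j%ℕn : ∀ i j → n ∣ ∣ i - j ∣ → i %ℕ n ≡ j %ℕ n
  n∣∣i-j∣⇒i%ℕn≡j%ℕn i j n∣i-j =
    ℤ.+-injective (ℤ.i-j≡0⇒i≡j (+ (i %ℕ n)) (+ (j %ℕ n)) (ℤ.∣i∣≡0⇒i≡0 (∣∧<⇒≡0 n∣r r<n)))
    where
    r : ℤ
    r = + (i %ℕ n) - + (j %ℕ n)
    n∣r : n ∣ ∣ r ∣
    n∣r = Signed.∣⇒∣ᵤ {i = r} (Signed.∣m+n∣n⇒∣m {m = r}
            (subst (+ n Signed.∣_) (i-j≡[i%-j%]+[i/-j/]*n i j) (Signed.∣ᵤ⇒∣ n∣i-j))
            (Signed.∣n⇒∣m*n (i /ℕ n - j /ℕ n) Signed.∣-refl))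
    r<n : ∣ r ∣ < n
    r<n = subst (_< n) (cong ∣_∣ (sym (ℤ.m-n≡m⊖n (i %ℕ n) (j %ℕ n))))
            (≤-<-trans (ℤ.∣m⊝n∣≤m⊔n (i %ℕ n) (j %ℕ n)) (⊔-lub (ℤ.n%ℕd<d i n) (ℤ.n%ℕd<d j n)))

[r+q*n]/n≡q : ∀ {r} q n .{{_ : NonZero n}} → r < n → (r + q * n) / n ≡ q
[r+q*n]/n≡q {r} q n r<n = trans (+-distrib-/ r (q * n) r%n+qn%n<n)
                                (cong₂ _+_ (m<n⇒m/n≡0 r<n) (m*n/n≡m q n))
  where
  r%n+qn%n<n : r % n + q * n % n < n
  r%n+qn%n<n = subst (_< n) (sym (trans (cong₂ _+_ (m<n⇒m%n≡m r<n) (m*n%n≡0 q n)) (+-identityʳ r)))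
                     r<n

/-suc : ∀ m n .{{_ : NonZero n}} → suc m / n ≡ m / n + 𝟙 (n ∣? suc m)
/-suc m n with m≤n⇒m<n∨m≡n (m%n<n m n)
... | inj₁ 1+r<n = begin
  suc m / n                       ≡⟨ cong (_/ n) 1+m≡1+r+q*n ⟩
  (suc (m % n) + m / n * n) / n   ≡⟨ [r+q*n]/n≡q (m / n) n 1+r<n ⟩
  m / n                           ≡⟨ +-identityʳ (m / n) ⟨
  m / n + 0                       ≡⟨ cong (_+_ (m / n)) (𝟙-no n∤1+m (n ∣? suc m)) ⟨
  m / n + 𝟙 (n ∣? suc m)          ∎
  where
  open ≡-Reasoning
  1+m≡1+r+q*n : suc m ≡ suc (m % n) + m / n * n
  1+m≡1+r+q*n = cong suc (m≡m%n+[m/n]*n m n)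
  n∤1+m : ¬ (n ∣ suc m)
  n∤1+m n∣1+m = 0≢1+n (begin
    0                                     ≡⟨ n∣m⇒m%n≡0 (suc m) n n∣1+m ⟨
    suc m % n                             ≡⟨ cong (_% n) 1+m≡1+r+q*n ⟩
    (suc (m % n) + m / n * n) % n         ≡⟨ [m+kn]%n≡m%n (suc (m % n)) (m / n) n ⟩
    suc (m % n) % n                       ≡⟨ m<n⇒m%n≡m 1+r<n ⟩
    suc (m % n)                           ∎)
... | inj₂ 1+r≡n = begin
  suc m / n                  ≡⟨ cong (_/ n) 1+m≡[1+q]*n ⟩
  suc (m / n) * n / n        ≡⟨ m*n/n≡m (suc (m / n)) n ⟩
  suc (m / n)                ≡⟨ +-comm 1 (m / n) ⟩
  m / n + 1                  ≡⟨ cong (_+_ (m / n)) (𝟙-yes n∣1+m (n ∣? suc m)) ⟨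
  m / n + 𝟙 (n ∣? suc m)     ∎
  where
  open ≡-Reasoning
  1+m≡[1+q]*n : suc m ≡ suc (m / n) * n
  1+m≡[1+q]*n = trans (cong suc (m≡m%n+[m/n]*n m n)) (cong (_+ m / n * n) 1+r≡n)
  n∣1+m : n ∣ suc m
  n∣1+m = divides (suc (m / n)) 1+m≡[1+q]*n

∑<-𝟙-digit : ∀ {A r} b n .{{_ : NonZero n}} → r < n → A < b * n →
             ∑< (λ t → 𝟙 (A ≟ r + t * n)) b ≡ 𝟙 (A % n ≟ r)
∑<-𝟙-digit {A} {r} b n r<n A<b*n with A % n ≟ r
... | yes A%n≡r = trans (∑<-cong b (λ t _ → 𝟙-cong (A ≟ r + t * n) (A / n ≟ t) to from))
                        (∑<-𝟙-≟ b (m<n*o⇒m/o<n A<b*n))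
  where
  A≡r+[A/n]*n : A ≡ r + A / n * n
  A≡r+[A/n]*n = trans (m≡m%n+[m/n]*n A n) (cong (_+ A / n * n) A%n≡r)
  to : ∀ {t} → A ≡ r + t * n → A / n ≡ t
  to {t} A≡r+t*n = trans (cong (_/ n) A≡r+t*n) ([r+q*n]/n≡q t n r<n)
  from : ∀ {t} → A / n ≡ t → A ≡ r + t * n
  from refl = A≡r+[A/n]*n
... | no A%n≢r = trans (∑<-cong b (λ t _ → 𝟙-no (A≢r+t*n t) (A ≟ r + t * n)))
                       (trans (∑<-const 0 b) (*-zeroʳ b))
  where
  A≢r+t*n : ∀ t → A ≢ r + t * n
  A≢r+t*n t A≡r+t*n = A%n≢r (trans (cong (_% n) A≡r+t*n)
                                   (trans ([m+kn]%n≡m%n r t n) (m<n⇒m%n≡m r<n)))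

prodBelow-cong : ∀ {f g} n → (∀ i → i < n → f i ≡ g i) → prodBelow f n ≡ prodBelow g n
prodBelow-cong zero    h = refl
prodBelow-cong (suc n) h = cong₂ _*_ (prodBelow-cong n (∀<suc⇒∀< h)) (h n ≤-refl)

prodBelow-distrib-* : ∀ f g n → prodBelow (λ i → f i * g i) n ≡ prodBelow f n * prodBelow g n
prodBelow-distrib-* f g zero    = refl
prodBelow-distrib-* f g (suc n) =
  trans (cong (_* (f n * g n)) (prodBelow-distrib-* f g n))
        (*-interchange (prodBelow f n) (prodBelow g n) (f n) (g n))

prodBelow-≢0 : ∀ f n → (∀ i → i < n → f i ≢ 0) → prodBelow f n ≢ 0
prodBelow-≢0 f (suc n) h ∏≡0 with m*n≡0⇒m≡0∨n≡0 (prodBelow f n) ∏≡0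
... | inj₁ ∏f≡0 = prodBelow-≢0 f n (∀<suc⇒∀< h) ∏f≡0
... | inj₂ fn≡0 = h n ≤-refl fn≡0

prodBelow-from-2 : ∀ f n → f 0 ≡ 1 → f 1 ≡ 1 → prodBelow f (2 + n) ≡ prodBelow (λ i → f (2 + i)) n
prodBelow-from-2 f zero    f0≡1 f1≡1 = cong₂ _*_ (cong (1 *_) f0≡1) f1≡1
prodBelow-from-2 f (suc n) f0≡1 f1≡1 = cong (_* f (2 + n)) (prodBelow-from-2 f n f0≡1 f1≡1)

*≤⇒≤/ : ∀ {m n} o .{{_ : NonZero o}} → m * o ≤ n → m ≤ n / o
*≤⇒≤/ {m} o m*o≤n = subst (_≤ _) (m*n/n≡m m o) (/-monoˡ-≤ o m*o≤n)

^-monoʳ-∣ : ∀ m {n o} → n ≤ o → m ^ n ∣ m ^ o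
^-monoʳ-∣ m {n} {o} n≤o = divides (m ^ (o ∸ n)) (begin
  m ^ o                   ≡⟨ cong (m ^_) (m+[n∸m]≡n n≤o) ⟨
  m ^ (n + (o ∸ n))       ≡⟨ ^-distribˡ-+-* m n (o ∸ n) ⟩
  m ^ n * m ^ (o ∸ n)     ≡⟨ *-comm (m ^ n) (m ^ (o ∸ n)) ⟩
  m ^ (o ∸ n) * m ^ n     ∎)
  where open ≡-Reasoning

-- Orders and Legendre's formula in a base b ≥ 2

module Base (c : ℕ) where

  b : ℕ
  b = 2 + c

  -- b ^ e, written as a successor so that instance search sees it is nonzero.
  b^_ : ℕ → ℕ
  b^ e = suc (pred (b ^ e))

  b^≡b^ : ∀ e → b^ e ≡ b ^ e
  b^≡b^ e = suc-pred (b ^ e) {{m^n≢0 b e}}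

  b^-suc : ∀ e → b^ suc e ≡ b^ e * b
  b^-suc e = trans (b^≡b^ (suc e)) (trans (*-comm b (b ^ e)) (cong (_* b) (sym (b^≡b^ e))))

  b^-monoʳ-∣ : ∀ {e e′} → e ≤ e′ → b^ e ∣ b^ e′
  b^-monoʳ-∣ {e} {e′} e≤e′ = subst₂ _∣_ (sym (b^≡b^ e)) (sym (b^≡b^ e′)) (^-monoʳ-∣ b e≤e′)

  n<b^n : ∀ n → n < b ^ n
  n<b^n zero    = s≤s z≤n
  n<b^n (suc n) = subst (_≤ b ^ suc n) (+-comm (suc n) 1)
                    (+-mono-≤ (n<b^n n) (*-mono-≤ (s≤s (z≤n {c})) (m^n>0 b n)))

  k<b^[1+e] : ∀ {k e} → k ≤ e → k < b^ suc e
  k<b^[1+e] {k} {e} k≤e = subst (k <_) (sym (b^≡b^ (suc e))) (<-trans (s≤s k≤e) (n<b^n (suc e)))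

  truncOrd : ℕ → ℕ → ℕ
  truncOrd E m = ∑< (λ e → 𝟙 (b ^ suc e ∣? m)) E

  greatestPowDiv≡truncOrd : ∀ m N → greatestPowDiv b m N ≡ truncOrd N m
  greatestPowDiv≡truncOrd m zero    = refl
  greatestPowDiv≡truncOrd m (suc N) with b ^ suc N ∣? m
  ... | yes b^[1+N]∣m = trans (+-comm 1 N) (cong (_+ 1) (sym truncOrd≡N))
    where
    truncOrd≡N : truncOrd N m ≡ N
    truncOrd≡N = trans (∑<-cong N (λ e e<N →
                          𝟙-yes (∣-trans (^-monoʳ-∣ b (s≤s (<⇒≤ e<N))) b^[1+N]∣m) (b ^ suc e ∣? m)))
                       (trans (∑<-const 1 N) (*-identityʳ N))
  ... | no _ = trans (greatestPowDiv≡truncOrd m N) (sym (+-identityʳ _))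

  truncOrd-stable : ∀ {m E E′} → (∀ e → E ≤ e → ¬ (b ^ suc e ∣ m)) → E ≤ E′ →
                    truncOrd E′ m ≡ truncOrd E m
  truncOrd-stable {m} b^∤m E≤E′ =
    ∑<-vanishing (λ e → 𝟙 (b ^ suc e ∣? m)) (λ e E≤e → 𝟙-no (b^∤m e E≤e) (b ^ suc e ∣? m)) E≤E′

  b^[1+e]∤m : ∀ {m e} → m ≢ 0 → m ≤ e → ¬ (b ^ suc e ∣ m)
  b^[1+e]∤m {m} {e} m≢0 m≤e b^[1+e]∣m =
    <⇒≱ (≤-<-trans m≤e (<-trans (n<1+n e) (n<b^n (suc e)))) (∣⇒≤ {{≢-nonZero m≢0}} b^[1+e]∣m)

  greatestPowDiv≡truncOrd-beyond : ∀ {m} E → m ≢ 0 → (∀ e → E ≤ e → ¬ (b ^ suc e ∣ m)) →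
                                   greatestPowDiv b m m ≡ truncOrd E m
  greatestPowDiv≡truncOrd-beyond {m} E m≢0 b^∤m = begin
    greatestPowDiv b m m   ≡⟨ greatestPowDiv≡truncOrd m m ⟩
    truncOrd m m           ≡⟨ truncOrd-stable (λ e → b^[1+e]∤m m≢0) (m≤n⊔m E m) ⟨
    truncOrd (E ⊔ m) m     ≡⟨ truncOrd-stable b^∤m (m≤m⊔n E m) ⟩
    truncOrd E m           ∎
    where open ≡-Reasoning

  truncOrd≤greatestPowDiv : ∀ {m} E → m ≢ 0 → truncOrd E m ≤ greatestPowDiv b m m
  truncOrd≤greatestPowDiv {m} E m≢0 = begin
    truncOrd E m           ≤⟨ ∑<-prefix≤ _ (m≤m⊔n E m) ⟩
    truncOrd (E ⊔ m) m     ≡⟨ truncOrd-stable (λ e → b^[1+e]∤m m≢0) (m≤n⊔m E m) ⟩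
    truncOrd m m           ≡⟨ greatestPowDiv≡truncOrd m m ⟨
    greatestPowDiv b m m   ∎
    where open ≤-Reasoning

  ord≡truncOrd : ∀ E y → ¬ (b ^ E ∣ ∣ y ∣) → ord b y ≡ fin (truncOrd E ∣ y ∣)
  ord≡truncOrd E y b^E∤y with ∣ y ∣ ≟ 0
  ... | yes y≡0 = ⊥-elim (b^E∤y (subst (b ^ E ∣_) (sym y≡0) ((b ^ E) ∣0)))
  ... | no y≢0  = cong fin (greatestPowDiv≡truncOrd-beyond E y≢0 λ e E≤e b^[1+e]∣y →
                    b^E∤y (∣-trans (^-monoʳ-∣ b (m≤n⇒m≤1+n E≤e)) b^[1+e]∣y))

  truncOrd≤ord : ∀ E y → fin (truncOrd E ∣ y ∣) ≤∞ ord b y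
  truncOrd≤ord E y with ∣ y ∣ ≟ 0
  ... | yes _   = _ ≤∞∞
  ... | no y≢0  = fin≤fin (truncOrd≤greatestPowDiv E y≢0)

  ord-+suc : ∀ m → ord b (+ suc m) ≡ fin (truncOrd (suc m) (suc m))
  ord-+suc m = ord≡truncOrd (suc m) (+ suc m) (>⇒∤ (n<b^n (suc m)))

  legendre : ℕ → ℕ
  legendre k = ∑< (λ e → k / b^ suc e) k

  legendre-extend : ∀ {k E} → k ≤ E → ∑< (λ e → k / b^ suc e) E ≡ legendre k
  legendre-extend {k} = ∑<-vanishing (λ e → k / b^ suc e) (λ e k≤e → m<n⇒m/n≡0 (k<b^[1+e] k≤e))

  legendre-suc : ∀ m → legendre (suc m) ≡ truncOrd (suc m) (suc m) + legendre m
  legendre-suc m = begin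
    legendre (suc m)
      ≡⟨ ∑<-cong (suc m) (λ e _ → /-suc m (b^ suc e)) ⟩
    ∑< (λ e → m / b^ suc e + 𝟙 (b^ suc e ∣? suc m)) (suc m)
      ≡⟨ ∑<-distrib-+ (λ e → m / b^ suc e) (λ e → 𝟙 (b^ suc e ∣? suc m)) (suc m) ⟩
    ∑< (λ e → m / b^ suc e) (suc m) + ∑< (λ e → 𝟙 (b^ suc e ∣? suc m)) (suc m)
      ≡⟨ cong₂ _+_ (legendre-extend (n≤1+n m)) (∑<-cong (suc m) (λ e _ → 𝟙-b^∣ (suc e))) ⟩
    legendre m + truncOrd (suc m) (suc m)
      ≡⟨ +-comm (legendre m) _ ⟩
    truncOrd (suc m) (suc m) + legendre m
      ∎
    where
    open ≡-Reasoning
    𝟙-b^∣ : ∀ e → 𝟙 (b^ e ∣? suc m) ≡ 𝟙 (b ^ e ∣? suc m)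
    𝟙-b^∣ e = 𝟙-cong _ _ (subst (_∣ suc m) (b^≡b^ e)) (subst (_∣ suc m) (sym (b^≡b^ e)))

  legendre-< : ∀ {k} → k < b → legendre k ≡ 0
  legendre-< {k} k<b = trans (∑<-cong k (λ e _ → m<n⇒m/n≡0 (<-≤-trans k<b (b≤b^[1+e] e))))
                             (trans (∑<-const 0 k) (*-zeroʳ k))
    where
    b≤b^[1+e] : ∀ e → b ≤ b^ suc e
    b≤b^[1+e] e = subst (b ≤_) (sym (b^-suc e)) (m≤n*m b (b^ e))

  residue : ℕ → ℤ → ℕ
  residue e x = x %ℕ b^ e

  residue< : ∀ e x → residue e x < b^ e
  residue< e x = ℤ.n%ℕd<d x (b^ e)

  𝟙-∣≡𝟙-residue-≡ : ∀ e x y → 𝟙 (b ^ e ∣? ∣ x - y ∣) ≡ 𝟙 (residue e y ≟ residue e x)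
  𝟙-∣≡𝟙-residue-≡ e x y = 𝟙-cong _ _
    (λ b^e∣x-y → sym (n∣∣i-j∣⇒i%ℕn≡j%ℕn (b^ e) x y (subst (_∣ ∣ x - y ∣) (sym (b^≡b^ e)) b^e∣x-y)))
    (λ y≡x → subst (_∣ ∣ x - y ∣) (b^≡b^ e) (i%ℕn≡j%ℕn⇒n∣∣i-j∣ (b^ e) x y (sym y≡x)))

  residue-nested : ∀ K x → residue K x ≡ residue (suc K) x % b^ K
  residue-nested K x = n∣∣i-j∣⇒i%ℕn≡j%ℕn (b^ K) x (+ r) (∣-trans (b^-monoʳ-∣ (n≤1+n K)) b^[1+K]∣x-r)
    where
    r : ℕ
    r = residue (suc K) x
    b^[1+K]∣x-r : b^ suc K ∣ ∣ x - + r ∣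
    b^[1+K]∣x-r = i%ℕn≡j%ℕn⇒n∣∣i-j∣ (b^ suc K) x (+ r) (sym (m<n⇒m%n≡m (residue< (suc K) x)))

  module Counting (a : ℕ → ℤ) where

    count : ℕ → ℕ → ℕ → ℕ
    count e k r = ∑< (λ j → 𝟙 (residue e (a j) ≟ r)) k

    count≤ : ∀ e k r → count e k r ≤ k
    count≤ e k r = subst (count e k r ≤_) (trans (∑<-const 1 k) (*-identityʳ k))
                         (∑<-mono-≤ k (λ j _ → 𝟙≤1 (residue e (a j) ≟ r)))

    ∑<-count : ∀ e k → ∑< (count e k) (b^ e) ≡ k
    ∑<-count e k = begin
      ∑< (count e k) (b^ e)
        ≡⟨ ∑<-comm _ (b^ e) k ⟩
      ∑< (λ j → ∑< (λ r → 𝟙 (residue e (a j) ≟ r)) (b^ e)) k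
        ≡⟨ ∑<-cong k (λ j _ → ∑<-𝟙-≟ (b^ e) (residue< e (a j))) ⟩
      ∑< (λ _ → 1) k
        ≡⟨ ∑<-const 1 k ⟩
      k * 1
        ≡⟨ *-identityʳ k ⟩
      k ∎
      where open ≡-Reasoning

    count-split : ∀ K k {r} → r < b^ K → ∑< (λ t → count (suc K) k (r + t * b^ K)) b ≡ count K k r
    count-split K k {r} r<b^K = trans (∑<-comm _ b k) (∑<-cong k λ j _ → begin
      ∑< (λ t → 𝟙 (residue (suc K) (a j) ≟ r + t * b^ K)) b
        ≡⟨ ∑<-𝟙-digit b (b^ K) r<b^K (ρ<b*b^K j) ⟩
      𝟙 (residue (suc K) (a j) % b^ K ≟ r)
        ≡⟨ cong (λ ρ → 𝟙 (ρ ≟ r)) (residue-nested K (a j)) ⟨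
      𝟙 (residue K (a j) ≟ r) ∎)
      where
      open ≡-Reasoning
      ρ<b*b^K : ∀ j → residue (suc K) (a j) < b * b^ K
      ρ<b*b^K j = subst (residue (suc K) (a j) <_) (trans (b^-suc K) (*-comm (b^ K) b))
                        (residue< (suc K) (a j))

    Balanced : ℕ → ℕ → Set
    Balanced e k = ∀ {r r′} → r < b^ e → r′ < b^ e → count e k r ≤ suc (count e k r′)

    balanced⇒/≤count : ∀ e k {r} → Balanced e k → r < b^ e → k / b^ e ≤ count e k r
    balanced⇒/≤count e k {r} balanced r<b^e = ≤-pred (m<n*o⇒m/o<n (begin-strict
      k                                  ≡⟨ ∑<-count e k ⟨
      ∑< (count e k) (b^ e)              <⟨ ∑<-<-* (count e k) (b^ e) (suc (count e k r))
                                              (λ r′ r′<b^e → balanced r′<b^e r<b^e) r<b^e (n<1+n _) ⟩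
      b^ e * suc (count e k r)           ≡⟨ *-comm (b^ e) _ ⟩
      suc (count e k r) * b^ e           ∎))
      where open ≤-Reasoning

    ∃-sparse-residue : ∀ k K → ∃ λ r → r < b^ K × (∀ e → e ≤ K → count e k (r % b^ e) ≤ k / b^ e)
    ∃-sparse-residue k zero =
      0 , s≤s z≤n , λ { zero z≤n → subst (count 0 k 0 ≤_) (sym (n/1≡n k)) (count≤ 0 k 0) }
    ∃-sparse-residue k (suc K) with ∃-sparse-residue k K
    ... | r , r<b^K , sparse = r′ , r′<b^[1+K] , sparse′
      where
      -- the next digit t selects a least populated of the b classes refining r mod b^K
      count-digit : ℕ → ℕ
      count-digit t = count (suc K) k (r + t * b^ K)
      t : ℕ
      t = proj₁ (∃-*≤∑< count-digit (suc c))
      t<b : t < b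
      t<b = proj₁ (proj₂ (∃-*≤∑< count-digit (suc c)))
      below-average : count-digit t * b ≤ ∑< count-digit b
      below-average = proj₂ (proj₂ (∃-*≤∑< count-digit (suc c)))
      r′ : ℕ
      r′ = r + t * b^ K
      r′<b^[1+K] : r′ < b^ suc K
      r′<b^[1+K] = begin-strict
        r + t * b^ K       <⟨ +-monoˡ-< (t * b^ K) r<b^K ⟩
        suc t * b^ K       ≤⟨ *-monoˡ-≤ (b^ K) t<b ⟩
        b * b^ K           ≡⟨ trans (*-comm b (b^ K)) (sym (b^-suc K)) ⟩
        b^ suc K           ∎
        where open ≤-Reasoning
      count-r′ : count (suc K) k r′ ≤ k / b^ suc K
      count-r′ = begin
        count (suc K) k r′                 ≤⟨ *≤⇒≤/ b (begin
          count (suc K) k r′ * b                ≤⟨ below-average ⟩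
          ∑< count-digit b                       ≡⟨ count-split K k r<b^K ⟩
          count K k r                            ≡⟨ cong (count K k) (m<n⇒m%n≡m r<b^K) ⟨
          count K k (r % b^ K)                   ≤⟨ sparse K ≤-refl ⟩
          k / b^ K                               ∎) ⟩
        k / b^ K / b                       ≡⟨ m/n/o≡m/[n*o] k (b^ K) b ⟩
        k / (b^ K * b)                     ≡⟨ /-congʳ {m = k} (sym (b^-suc K)) ⟩
        k / b^ suc K                       ∎
        where open ≤-Reasoning
      sparse′ : ∀ e → e ≤ suc K → count e k (r′ % b^ e) ≤ k / b^ e
      sparse′ e e≤1+K with m≤n⇒m<n∨m≡n e≤1+K
      ... | inj₂ refl  = subst (λ ρ → count e k ρ ≤ k / b^ e) (sym (m<n⇒m%n≡m r′<b^[1+K]))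
                               count-r′
      ... | inj₁ e<1+K = subst (λ ρ → count e k ρ ≤ k / b^ e)
                               (sym (%-remove-+ʳ r (∣n⇒∣m*n t (b^-monoʳ-∣ (≤-pred e<1+K)))))
                               (sparse e (≤-pred e<1+K))

    score : ℕ → ℤ → ℕ∞
    score k x = sumBelow (λ j → ord b (x - a j)) k

    agreements : ℕ → ℕ → ℤ → ℕ
    agreements E k x = ∑< (λ e → count (suc e) k (residue (suc e) x)) E

    ∑<truncOrd≡agreements : ∀ E k x → ∑< (λ j → truncOrd E ∣ x - a j ∣) k ≡ agreements E k x
    ∑<truncOrd≡agreements E k x = trans (∑<-comm _ k E)
      (∑<-cong E (λ e _ → ∑<-cong k (λ j _ → 𝟙-∣≡𝟙-residue-≡ (suc e) x (a j))))

    agreements≤score : ∀ E k x → fin (agreements E k x) ≤∞ score k x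
    agreements≤score E k x = subst (_≤∞ score k x) (cong fin (∑<truncOrd≡agreements E k x))
      (∑<≤sumBelow _ _ k (λ j _ → truncOrd≤ord E (x - a j)))

    score≡agreements : ∀ k x → count k k (residue k x) ≡ 0 → score k x ≡ fin (agreements k k x)
    score≡agreements k x unmatched = trans
      (sumBelow-fin _ _ k (λ j j<k → ord≡truncOrd k (x - a j) (b^k∤x-aⱼ j<k)))
      (cong fin (∑<truncOrd≡agreements k k x))
      where
      b^k∤x-aⱼ : ∀ {j} → j < k → ¬ (b ^ k ∣ ∣ x - a j ∣)
      b^k∤x-aⱼ {j} j<k b^k∣x-aⱼ = n≮0 (begin
        1                                        ≡⟨ 𝟙-yes b^k∣x-aⱼ (b ^ k ∣? ∣ x - a j ∣) ⟨
        𝟙 (b ^ k ∣? ∣ x - a j ∣)                 ≡⟨ 𝟙-∣≡𝟙-residue-≡ k x (a j) ⟩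
        𝟙 (residue k (a j) ≟ residue k x)        ≤⟨ ∑<-term≤ (λ i → 𝟙 (residue k (a i) ≟ residue k x)) k j<k ⟩
        count k k (residue k x)                  ≡⟨ unmatched ⟩
        0                                        ∎)
        where open ≤-Reasoning

    ∃-score≤legendre : ∀ k → ∃ λ x → score k x ≤∞ fin (legendre k)
    ∃-score≤legendre k = + r , subst (_≤∞ fin (legendre k)) (sym (score≡agreements k (+ r) unmatched))
                                     (fin≤fin (∑<-mono-≤ k (λ e e<k → sparse (suc e) e<k)))
      where
      r : ℕ
      r = proj₁ (∃-sparse-residue k k)
      sparse : ∀ e → e ≤ k → count e k (r % b^ e) ≤ k / b^ e
      sparse = proj₂ (proj₂ (∃-sparse-residue k k))
      unmatched : count k k (r % b^ k) ≡ 0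
      unmatched = n≤0⇒n≡0 (subst (count k k (r % b^ k) ≤_) (m<n⇒m/n≡0 k<b^k) (sparse k ≤-refl))
        where
        k<b^k : k < b^ k
        k<b^k = subst (k <_) (sym (b^≡b^ k)) (n<b^n k)

    legendre≤agreements : ∀ k → (∀ e → Balanced e k) → ∀ x → legendre k ≤ agreements k k x
    legendre≤agreements k balanced x =
      ∑<-mono-≤ k (λ e _ → balanced⇒/≤count (suc e) k (balanced (suc e)) (residue< (suc e) x))

  module _ {a : ℕ → ℤ} (isOrd : IsBOrdering (λ _ → ⊤) b a) where
    open Counting a

    score-aₖ≤legendre : ∀ k → score k (a k) ≤∞ fin (legendre k)
    score-aₖ≤legendre zero    = fin≤fin z≤n
    score-aₖ≤legendre (suc k) = ≤∞-trans (proj₂ isOrd (suc k) (s≤s z≤n) x tt) score-x≤legendre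
      where
      x : ℤ
      x = proj₁ (∃-score≤legendre (suc k))
      score-x≤legendre : score (suc k) x ≤∞ fin (legendre (suc k))
      score-x≤legendre = proj₂ (∃-score≤legendre (suc k))

    module _ (k : ℕ) (bal : ∀ e → Balanced e k) where

      score-aₖ≡legendre : score k (a k) ≡ fin (legendre k)
      score-aₖ≡legendre = ≤∞-antisym-fin (score-aₖ≤legendre k)
        (≤∞-trans (fin≤fin (legendre≤agreements k bal (a k))) (agreements≤score k k (a k)))

      aₖ-sparsest : ∀ e {r} → r < b^ e → count e k (residue e (a k)) ≤ count e k r
      aₖ-sparsest zero    {r} r<1 = subst₂ (λ ρ ρ′ → count 0 k ρ ≤ count 0 k ρ′)
                                      (sym (n<1⇒n≡0 (residue< 0 (a k)))) (sym (n<1⇒n≡0 r<1)) ≤-refl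
      aₖ-sparsest (suc e) {r} r<b^[1+e] = begin
        count (suc e) k (residue (suc e) (a k))  ≡⟨ /≡count ⟨
        k / b^ suc e                             ≤⟨ balanced⇒/≤count (suc e) k (bal (suc e)) r<b^[1+e] ⟩
        count (suc e) k r                        ∎
        where
        -- score k (a k) = legendre k squeezes the termwise larger sum of counts onto the sum of
        -- floors, so the two agree at every level.
        open ≤-Reasoning
        E : ℕ
        E = suc e + k
        agreements≤legendre : agreements E k (a k) ≤ ∑< (λ e′ → k / b^ suc e′) E
        agreements≤legendre = fin-≤∞⁻¹ (≤∞-trans (agreements≤score E k (a k))
          (subst (λ L → score k (a k) ≤∞ fin L) (sym (legendre-extend (m≤n+m k (suc e))))
                 (score-aₖ≤legendre k)))
        /≡count : k / b^ suc e ≡ count (suc e) k (residue (suc e) (a k))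
        /≡count = ∑<-pointwise-≡ E
          (λ e′ _ → balanced⇒/≤count (suc e′) k (bal (suc e′)) (residue< (suc e′) (a k)))
          agreements≤legendre e (m≤m+n (suc e) k)

    balanced-suc : ∀ {k} → (∀ e → Balanced e k) → ∀ e → Balanced e (suc k)
    balanced-suc {k} bal e {r} {r′} r<b^e r′<b^e
      with residue e (a k) ≟ r | residue e (a k) ≟ r′
    ... | yes refl | r≟r′ =
      subst (_≤ suc (count e k r′ + 𝟙 r≟r′)) (+-comm 1 (count e k r))
            (s≤s (≤-trans (aₖ-sparsest k bal e r′<b^e) (m≤m+n (count e k r′) (𝟙 r≟r′))))
    ... | no _     | r≟r′ =
      subst (_≤ suc (count e k r′ + 𝟙 r≟r′)) (sym (+-identityʳ (count e k r)))
            (≤-trans (bal e r<b^e r′<b^e) (s≤s (m≤m+n (count e k r′) (𝟙 r≟r′))))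

    balanced : ∀ k e → Balanced e k
    balanced zero    e _ _ = z≤n
    balanced (suc k)       = balanced-suc (balanced k)

    alphaOf≡legendre : ∀ k → alphaOf b a k ≡ fin (legendre k)
    alphaOf≡legendre k = score-aₖ≡legendre k (balanced k)

-- Generalized factorials of ℤ

≤∞-fin0⇒≡fin0 : ∀ {x} → x ≤∞ fin 0 → x ≡ fin 0
≤∞-fin0⇒≡fin0 (fin≤fin z≤n) = refl

ord0≡0 : ∀ y → ∣ y ∣ ≢ 0 → ord 0 y ≡ fin 0
ord0≡0 y y≢0 with ∣ y ∣ ≟ 0
... | yes y≡0 = ⊥-elim (y≢0 y≡0)
... | no _    = refl

alphaOf-0 : ∀ {a} → IsBOrdering (λ _ → ⊤) 0 a → ∀ k → alphaOf 0 a k ≡ fin 0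
alphaOf-0     isOrd zero    = refl
alphaOf-0 {a} isOrd (suc k) =
  ≤∞-fin0⇒≡fin0 (subst (alphaOf 0 a (suc k) ≤∞_) score-x≡0 (proj₂ isOrd (suc k) (s≤s z≤n) x tt))
  where
  bound : ℕ
  bound = ∑< (λ j → ∣ a j ∣) (suc k)
  x : ℤ
  x = + suc bound
  x-aⱼ≢0 : ∀ j → j < suc k → ∣ x - a j ∣ ≢ 0
  x-aⱼ≢0 j j<1+k x-aⱼ≡0 =
    <-irrefl refl (subst (_≤ bound) (cong ∣_∣ aⱼ≡x) (∑<-term≤ (λ i → ∣ a i ∣) (suc k) j<1+k))
    where
    aⱼ≡x : a j ≡ x
    aⱼ≡x = sym (ℤ.i-j≡0⇒i≡j x (a j) (ℤ.∣i∣≡0⇒i≡0 x-aⱼ≡0))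
  score-x≡0 : sumBelow (λ j → ord 0 (x - a j)) (suc k) ≡ fin 0
  score-x≡0 = trans
    (sumBelow-fin _ (λ _ → 0) (suc k) (λ j j<1+k → ord0≡0 (x - a j) (x-aⱼ≢0 j j<1+k)))
    (cong fin (trans (∑<-const 0 (suc k)) (*-zeroʳ (suc k))))

pow∞-1 : ∀ x → pow∞ 1 x ≡ 1
pow∞-1 (fin m) = ^-zeroˡ m
pow∞-1 ∞       = refl

legendreProduct : ℕ → ℕ → ℕ
legendreProduct k n = prodBelow (λ c → (2 + c) ^ Base.legendre c k) n

legendreProduct-≢0 : ∀ k n → legendreProduct k n ≢ 0
legendreProduct-≢0 k n =
  prodBelow-≢0 _ n (λ c _ → ≢-nonZero⁻¹ _ {{m^n≢0 (2 + c) (Base.legendre c k)}})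

legendreProduct-suc : ∀ m n → legendreProduct (suc m) n ≡
                      prod2To (λ b → pow∞ b (ord b (+ suc m))) (suc n) * legendreProduct m n
legendreProduct-suc m n = trans (prodBelow-cong n (λ c _ → factor-suc c)) (prodBelow-distrib-* _ _ n)
  where
  factor-suc : ∀ c → (2 + c) ^ Base.legendre c (suc m) ≡
                     pow∞ (2 + c) (ord (2 + c) (+ suc m)) * (2 + c) ^ Base.legendre c m
  factor-suc c = begin
    b ^ legendre (suc m)
      ≡⟨ cong (b ^_) (legendre-suc m) ⟩
    b ^ (truncOrd (suc m) (suc m) + legendre m)
      ≡⟨ ^-distribˡ-+-* b (truncOrd (suc m) (suc m)) (legendre m) ⟩
    b ^ truncOrd (suc m) (suc m) * b ^ legendre m
      ≡⟨ cong (λ o → pow∞ b o * b ^ legendre m) (ord-+suc m) ⟨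
    pow∞ b (ord b (+ suc m)) * b ^ legendre m ∎
    where
    open ≡-Reasoning
    open Base c

isFactorial : ∀ orders → (∀ b → IsBOrdering (λ _ → ⊤) b (orders b)) →
              ∀ k n → k ≤ suc n → IsFactorialℤℕ orders k (legendreProduct k n)
isFactorial orders isOrd k n k≤1+n = 2 + n , trivial-beyond , trans
  (prodBelow-from-2 factor n (cong (pow∞ 0) (alphaOf-0 (isOrd 0) k)) (pow∞-1 (alphaOf 1 (orders 1) k)))
  (prodBelow-cong n (λ c _ → factor-2+ c))
  where
  factor : ℕ → ℕ
  factor b = pow∞ b (alphaOf b (orders b) k)
  factor-2+ : ∀ c → factor (2 + c) ≡ (2 + c) ^ Base.legendre c k
  factor-2+ c = cong (pow∞ (2 + c)) (Base.alphaOf≡legendre c (isOrd (2 + c)) k)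
  trivial-beyond : ∀ b → 2 + n ≤ b → factor b ≡ 1
  trivial-beyond (suc (suc c)) (s≤s (s≤s n≤c)) =
    trans (factor-2+ c) (cong ((2 + c) ^_) (Base.legendre-< c (s≤s (≤-trans k≤1+n (s≤s n≤c)))))

theorem7p3 : (orders : ℕ → ℕ → ℤ) → ((b : ℕ) → IsBOrdering (λ _ → ⊤) b (orders b)) →
    (n : ℕ) → 1 ≤ n →
      IsGenIntℤℕ orders n (prod2To (λ b → pow∞ b (ord b (+ n))) n)
theorem7p3 orders isOrd (suc m) _ =
  legendreProduct (suc m) m , legendreProduct m m ,
  isFactorial orders isOrd (suc m) m ≤-refl , isFactorial orders isOrd m m (n≤1+n m) ,
  legendreProduct-≢0 m m , legendreProduct-suc m m
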